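{- Let $G=(V,E)$ be an undirected graph, let $s,\ell\ge 1$ be integers, and let $S\subseteq V$. Let $G'=(S,E')$ be a spanning subgraph of $G[S]$ such that every edge of $E'$ is contained in at least $\ell$ triangles of $G'$ and the diameter of $G'$ is at most $s$. If $\ell$ edges are removed from $G'$, then in the resulting graph $S$ is still an $(s+\ell)$-club and a $(2s)$-club, i.e., the resulting graph on vertex set $S$ has diameter at most $s+\ell$ and at most $2s$.
   Context: For a graph $H$ and a vertex set $S$, $H[S]$ denotes the subgraph induced by $S$. A triangle is a set of three pairwise adjacent vertices. A set $S$ is an $s$-club in a graph if the subgraph on $S$ under consideration has diameter at most $s$ (the diameter being the maximum over pairs of vertices of the length of a shortest path). A spanning subgraph of $G[S]$ is a graph with vertex set $S$ and an edge set contained in that of $G[S]$. -}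

module Defs where

open import Level using (0ℓ)
open import Data.Nat using (ℕ; zero; suc; _≤_)
open import Data.Fin using (Fin)
open import Data.Product using (_×_; Σ; ∃; _,_)
open import Data.Sum using (_⊎_)
open import Data.List using (List; length)
open import Data.List.Membership.Propositional using (_∈_)
open import Data.List.Relation.Unary.All using (All)
open import Data.List.Relation.Unary.AllPairs using (AllPairs)
open import Data.List.Relation.Unary.Unique.Propositional using (Unique)
open import Relation.Nullary using (¬_)
open import Relation.Binary.PropositionalEquality using (_≡_)

record Graph (n : ℕ) : Set₁ where
  field
    Adj   : Fin n → Fin n → Set
    sym   : ∀ {u v} → Adj u v → Adj v u
    irref : ∀ {u} → ¬ Adj u u
open Graph public

VSet : ℕ → Set₁
VSet n = Fin n → Set

-- H is a spanning subgraph of G[S]: every edge of H joins two vertices of S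
-- and is an edge of G. (Vertices of H are exactly those of S; vertices outside
-- S are isolated and are ignored by the diameter notion below.)
SpanningSubgraphOfInduced : ∀ {n} → Graph n → VSet n → Graph n → Set
SpanningSubgraphOfInduced G S H =
  ∀ {u v} → Adj H u v → S u × S v × Adj G u v

data Walk {n} (H : Graph n) : ℕ → Fin n → Fin n → Set where
  here : ∀ {u} → Walk H zero u u
  step : ∀ {k u w v} → Adj H u w → Walk H k w v → Walk H (suc k) u v

-- dist_H(u,v) ≤ k  (a shortest path has length ≤ k iff some walk of length ≤ k exists)
DistLE : ∀ {n} → Graph n → Fin n → Fin n → ℕ → Set
DistLE H u v k = ∃ λ m → m ≤ k × Walk H m u v

-- The graph H on vertex set S has diameter at most k
-- (equivalently, S is a k-club in H).
DiamLE : ∀ {n} → Graph n → VSet n → ℕ → Set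
DiamLE H S k = ∀ u v → S u → S v → DistLE H u v k

-- Triangles of H containing the edge {u,v}: the common neighbours w.
-- "edge uv lies in at least ℓ triangles of H": there are ℓ distinct such w.
InAtLeastTriangles : ∀ {n} → Graph n → ℕ → Fin n → Fin n → Set
InAtLeastTriangles {n} H ℓ u v =
  Σ (List (Fin n)) λ ws → length ws ≡ ℓ × Unique ws
    × All (λ w → Adj H u w × Adj H v w) ws

-- An (ordered representative of an) edge.
Edge : ℕ → Set
Edge n = Fin n × Fin n

SameEdge : ∀ {n} → Edge n → Edge n → Set
SameEdge (a , b) (c , d) = (a ≡ c × b ≡ d) ⊎ (a ≡ d × b ≡ c)

Hits : ∀ {n} → List (Edge n) → Fin n → Fin n → Set
Hits {n} es u v = Σ (Edge n) λ e → e ∈ es × SameEdge e (u , v)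

DistinctEdgesOf : ∀ {n} → Graph n → List (Edge n) → Set
DistinctEdgesOf H es =
  All (λ e → Adj H (Data.Product.proj₁ e) (Data.Product.proj₂ e)) es
  × AllPairs (λ e f → ¬ SameEdge e f) es

removeEdges : ∀ {n} → Graph n → List (Edge n) → Graph n
removeEdges {n} H es = record
  { Adj   = λ u v → Adj H u v × ¬ Hits es u v
  ; sym   = λ { (a , nh) → sym H a , λ { (e , e∈ , se) → nh (e , e∈ , flip se) } }
  ; irref = λ { (a , _) → irref H a }
  }
  where
  flip : ∀ {e : Edge n} {u v} → SameEdge e (v , u) → SameEdge e (u , v)
  flip (Data.Sum.inj₁ (p , q)) = Data.Sum.inj₂ (p , q)
  flip (Data.Sum.inj₂ (p , q)) = Data.Sum.inj₁ (p , q)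

-- Let F be G' with the ℓ edges removed. A removed edge ab lies in ℓ triangles a w b of G', and
-- their edges aw, wb differ from ab and from those of the other triangles; destroying all of them
-- would take ℓ removed edges besides ab, so some triangle survives and a, b keep a common
-- neighbour in F. Hence every edge of G' is replaced by a path of length at most 2 in F, which at
-- most doubles distances; and removing the edges one at a time, each removal costs at most one
-- detour through such a common neighbour, hence one unit of distance.
module Submission where

open import Defs
open import Data.Nat using (ℕ; suc; _≤_; _<_; _+_; _*_; z≤n; s≤s)
open import Data.Nat.Properties using (≤-refl; ≤-trans; ≤-reflexive; n≤1+n; +-mono-≤; *-monoˡ-≤; +-comm; *-comm; ≤⇒≯)
open import Data.Fin using (Fin) renaming (_≟_ to _≟ᶠ_)
open import Data.Fin.Properties using (injective⇒≤; punchOut-injective)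
open import Data.Product using (_×_; ∃; _,_; proj₁; proj₂)
open import Data.Sum using (_⊎_; inj₁; inj₂)
open import Data.Empty using (⊥-elim)
open import Data.List using (List; []; _∷_; length; lookup)
open import Data.List.Relation.Unary.Any as Any using (here; there; any?)
open import Data.List.Relation.Unary.Any.Properties using (lookup-index)
open import Data.List.Relation.Unary.All as All using (All; _∷_)
open import Data.List.Relation.Unary.All.Properties using (¬Any⇒All¬)
open import Data.List.Relation.Unary.AllPairs using (_∷_)
open import Data.List.Relation.Unary.Unique.Propositional using (Unique)
open import Data.List.Membership.Propositional using (_∈_; find; lose)
open import Data.List.Membership.Propositional.Properties using (∈-lookup)
open import Function using (_∘_)
open import Function.Definitions using (Injective)
open import Relation.Nullary using (¬_; Dec; yes; no)
open import Relation.Nullary.Decidable using (map′; _×-dec_; _⊎-dec_; ¬?)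
open import Relation.Binary.PropositionalEquality using (_≡_; _≢_; refl; trans; cong) renaming (sym to ≡-sym)

private
  variable
    n : ℕ

module _ {H : Graph n} where

  _++ʷ_ : ∀ {j k u w v} → Walk H j u w → Walk H k w v → Walk H (j + k) u v
  here     ++ʷ q = q
  step e p ++ʷ q = step e (p ++ʷ q)

  DistLE-weaken : ∀ {j k u v} → j ≤ k → DistLE H u v j → DistLE H u v k
  DistLE-weaken j≤k (m , m≤j , p) = m , ≤-trans m≤j j≤k , p

  DistLE-refl : ∀ {u} → DistLE H u u 0
  DistLE-refl = 0 , z≤n , here

  DistLE-cons : ∀ {k u w v} → Adj H u w → DistLE H w v k → DistLE H u v (suc k)
  DistLE-cons e (m , m≤k , p) = suc m , s≤s m≤k , step e p

  DistLE-trans : ∀ {j k u w v} → DistLE H u w j → DistLE H w v k → DistLE H u v (j + k)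
  DistLE-trans (i , i≤j , p) (m , m≤k , q) = i + m , +-mono-≤ i≤j m≤k , p ++ʷ q

  DistLE-edge : ∀ {u v} → Adj H u v → DistLE H u v 1
  DistLE-edge e = DistLE-cons e DistLE-refl

DistLE-mono : ∀ {A B : Graph n} {k u v} → (∀ {x y} → Adj A x y → Adj B x y)
  → DistLE A u v k → DistLE B u v k
DistLE-mono {A = A} {B} A⊆B (m , m≤k , p) = m , m≤k , walk p
  where
  walk : ∀ {m u v} → Walk A m u v → Walk B m u v
  walk here       = here
  walk (step e p) = step (A⊆B e) (walk p)

DistLE-stretch : ∀ {A B : Graph n} {c k u v} → (∀ {x y} → Adj A x y → DistLE B x y c)
  → DistLE A u v k → DistLE B u v (k * c)
DistLE-stretch {A = A} {B} {c} edge (m , m≤k , p) = DistLE-weaken (*-monoˡ-≤ c m≤k) (stretch p)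
  where
  stretch : ∀ {m u v} → Walk A m u v → DistLE B u v (m * c)
  stretch here       = DistLE-refl
  stretch (step e p) = DistLE-trans (edge e) (stretch p)

sameEdge? : (e f : Edge n) → Dec (SameEdge e f)
sameEdge? (a , b) (c , d) = ((a ≟ᶠ c) ×-dec (b ≟ᶠ d)) ⊎-dec ((a ≟ᶠ d) ×-dec (b ≟ᶠ c))

hits? : (es : List (Edge n)) (x y : Fin n) → Dec (Hits es x y)
hits? es x y = map′ find (λ (e , e∈ , same) → lose e∈ same) (any? (λ e → sameEdge? e (x , y)) es)

SameEdge-swap : ∀ {e : Edge n} {x y} → SameEdge e (x , y) → SameEdge e (y , x)
SameEdge-swap (inj₁ (p , q)) = inj₂ (p , q)
SameEdge-swap (inj₂ (p , q)) = inj₁ (p , q)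

Hits-swap : ∀ {es : List (Edge n)} {x y} → Hits es x y → Hits es y x
Hits-swap (e , e∈ , same) = e , e∈ , SameEdge-swap same

SameEdge-endpoint : ∀ {a b o w : Fin n} → SameEdge (a , b) (o , w) → w ≡ a ⊎ w ≡ b
SameEdge-endpoint (inj₁ (_ , refl)) = inj₂ refl
SameEdge-endpoint (inj₂ (refl , _)) = inj₁ refl

SameEdge-far-end : ∀ {e : Edge n} {o₁ w₁ o₂ w₂} → o₁ ≢ w₂ → o₂ ≢ w₁
  → SameEdge e (o₁ , w₁) → SameEdge e (o₂ , w₂) → w₁ ≡ w₂
SameEdge-far-end _    _    (inj₁ (refl , refl)) (inj₁ (refl , refl)) = refl
SameEdge-far-end o₁≢w _    (inj₁ (refl , refl)) (inj₂ (refl , refl)) = ⊥-elim (o₁≢w refl)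
SameEdge-far-end _    o₂≢w (inj₂ (refl , refl)) (inj₁ (refl , refl)) = ⊥-elim (o₂≢w refl)
SameEdge-far-end _    _    (inj₂ (refl , refl)) (inj₂ (refl , refl)) = refl

Adj⇒≢ : (H : Graph n) → ∀ {x y} → Adj H x y → x ≢ y
Adj⇒≢ H e refl = irref H e

CommonNeighbour : Graph n → Edge n → Set
CommonNeighbour H (a , b) = ∃ λ w → Adj H a w × Adj H w b

CommonNeighbour-mono : ∀ {A B : Graph n} → (∀ {x y} → Adj A x y → Adj B x y)
  → ∀ {e} → CommonNeighbour A e → CommonNeighbour B e
CommonNeighbour-mono A⊆B (w , aw , wb) = w , A⊆B aw , A⊆B wb

CommonNeighbour-swap : ∀ {H : Graph n} {e x y} → SameEdge e (x , y)
  → CommonNeighbour H e → CommonNeighbour H (x , y)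
CommonNeighbour-swap         (inj₁ (refl , refl)) c              = c
CommonNeighbour-swap {H = H} (inj₂ (refl , refl)) (w , aw , wb) = w , sym H wb , sym H aw

CommonNeighbour⇒DistLE : ∀ {H : Graph n} {x y} → CommonNeighbour H (x , y) → DistLE H x y 2
CommonNeighbour⇒DistLE (w , xw , wy) = DistLE-cons xw (DistLE-edge wy)

removeEdges-∷-⊆ : ∀ {H : Graph n} {e es x y}
  → Adj (removeEdges H (e ∷ es)) x y → Adj (removeEdges H es) x y
removeEdges-∷-⊆ (xy , ¬hit) = xy , λ (f , f∈ , same) → ¬hit (f , there f∈ , same)

DistLE-bypass : ∀ {H : Graph n} {es} → All (CommonNeighbour (removeEdges H es)) es
  → ∀ {x y} → Adj H x y → DistLE (removeEdges H es) x y 2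
DistLE-bypass {H = H} {es} bypasses {x} {y} xy with hits? es x y
... | no ¬hit             = DistLE-weaken (n≤1+n 1) (DistLE-edge {H = removeEdges H es} (xy , ¬hit))
... | yes (e , e∈ , same) =
  CommonNeighbour⇒DistLE (CommonNeighbour-swap {H = removeEdges H es} same (All.lookup bypasses e∈))

module _ {A B : Graph n} {a b w : Fin n}
         (keep : ∀ {x y} → Adj A x y → ¬ SameEdge (a , b) (x , y) → Adj B x y)
         (aw : Adj B a w) (wb : Adj B w b) where

  -- A walk in A traversing ab several times still costs only one detour a w b in B:
  -- once it is paid, both a and b are within budget of the target.
  private
    Budget : Fin n → Fin n → ℕ → Set
    Budget x v k = DistLE B x v k
      ⊎ (DistLE B x v (suc k) × DistLE B a v (suc k) × DistLE B b v (suc k))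

    budget : ∀ {m x v} → Walk A m x v → Budget x v m
    budget here = inj₁ DistLE-refl
    budget {x = x} (step {w = z} e p) with sameEdge? (a , b) (x , z) | budget p
    ... | no other | inj₁ d = inj₁ (DistLE-cons (keep e other) d)
    ... | no other | inj₂ (d , da , db) =
      inj₂ (DistLE-cons (keep e other) d , DistLE-weaken (n≤1+n _) da , DistLE-weaken (n≤1+n _) db)
    ... | yes (inj₁ (refl , refl)) | inj₁ d =
      let da = DistLE-cons aw (DistLE-cons wb d)
      in inj₂ (da , da , DistLE-weaken (≤-trans (n≤1+n _) (n≤1+n _)) d)
    ... | yes (inj₁ (refl , refl)) | inj₂ (_ , da , _) = inj₁ da
    ... | yes (inj₂ (refl , refl)) | inj₁ d =
      let db = DistLE-cons (sym B wb) (DistLE-cons (sym B aw) d)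
      in inj₂ (db , DistLE-weaken (≤-trans (n≤1+n _) (n≤1+n _)) d , db)
    ... | yes (inj₂ (refl , refl)) | inj₂ (_ , _ , db) = inj₁ db

  DistLE-removeEdge : ∀ {k u v} → DistLE A u v k → DistLE B u v (suc k)
  DistLE-removeEdge (m , m≤k , p) with budget p
  ... | inj₁ d       = DistLE-weaken (≤-trans m≤k (n≤1+n _)) d
  ... | inj₂ (d , _) = DistLE-weaken (s≤s m≤k) d

DistLE-removeEdges : ∀ {H : Graph n} (es : List (Edge n))
  → All (CommonNeighbour (removeEdges H es)) es
  → ∀ {k u v} → DistLE H u v k → DistLE (removeEdges H es) u v (length es + k)
DistLE-removeEdges []             _                             d = DistLE-mono (λ xy → xy , λ ()) d
DistLE-removeEdges {H = H} ((a , b) ∷ es) ((w , aw , wb) ∷ bypasses) d =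
  DistLE-removeEdge keep aw wb
    (DistLE-removeEdges es (All.map shrink bypasses) d)
  where
  shrink : ∀ {e} → CommonNeighbour (removeEdges H ((a , b) ∷ es)) e → CommonNeighbour (removeEdges H es) e
  shrink = CommonNeighbour-mono {A = removeEdges H ((a , b) ∷ es)} {B = removeEdges H es}
    (removeEdges-∷-⊆ {H = H} {a , b} {es})

  keep : ∀ {x y} → Adj (removeEdges H es) x y → ¬ SameEdge (a , b) (x , y)
    → Adj (removeEdges H ((a , b) ∷ es)) x y
  keep (xy , ¬hit) other = xy , λ where
    (_ , here refl , same) → other same
    (f , there f∈  , same) → ¬hit (f , f∈ , same)

injective-missing⇒< : ∀ {m n} {f : Fin m → Fin n} → Injective _≡_ _≡_ f
  → (j : Fin n) → (∀ i → f i ≢ j) → m < n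
injective-missing⇒< {n = suc _} {f} f-inj j missing =
  s≤s (injective⇒≤ λ eq → f-inj (punchOut-injective (missing _ ∘ ≡-sym) (missing _ ∘ ≡-sym) eq))

index-injective : ∀ {A : Set} {xs : List A} {x y} (p : x ∈ xs) (q : y ∈ xs)
  → Any.index p ≡ Any.index q → x ≡ y
index-injective {xs = xs} p q eq = trans (lookup-index p) (trans (cong (lookup xs) eq) (≡-sym (lookup-index q)))

lookup-injective : ∀ {A : Set} {xs : List A} → Unique xs → ∀ {i j} → lookup xs i ≡ lookup xs j → i ≡ j
lookup-injective (_ ∷ _)    {Fin.zero}  {Fin.zero}  _  = refl
lookup-injective (x≢xs ∷ _) {Fin.zero}  {Fin.suc j} eq = ⊥-elim (All.lookup x≢xs (∈-lookup j) eq)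
lookup-injective (x≢xs ∷ _) {Fin.suc i} {Fin.zero}  eq = ⊥-elim (All.lookup x≢xs (∈-lookup i) (≡-sym eq))
lookup-injective (_ ∷ uniq) {Fin.suc i} {Fin.suc j} eq = cong Fin.suc (lookup-injective uniq eq)

module _ {H : Graph n} {a b : Fin n} (es : List (Edge n)) where

  private
    Broken : Fin n → Set
    Broken w = ∃ λ o → (o ≡ a ⊎ o ≡ b) × Hits es o w

    broken : ∀ w → ¬ (¬ Hits es a w × ¬ Hits es w b) → Broken w
    broken w intact with hits? es a w | hits? es w b
    ... | yes aw-hit | _          = a , inj₁ refl , aw-hit
    ... | no _       | yes wb-hit = b , inj₂ refl , Hits-swap wb-hit
    ... | no aw-kept | no wb-kept = ⊥-elim (intact (aw-kept , wb-kept))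

    apex-≢ : ∀ {o w} → o ≡ a ⊎ o ≡ b → Adj H a w × Adj H b w → o ≢ w
    apex-≢ (inj₁ refl) (aw , _) = Adj⇒≢ H aw
    apex-≢ (inj₂ refl) (_ , bw) = Adj⇒≢ H bw

  triangle-survives : ∀ {ℓ} → (a , b) ∈ es → length es ≤ ℓ
    → InAtLeastTriangles H ℓ a b → CommonNeighbour (removeEdges H es) (a , b)
  triangle-survives ab∈ es≤ℓ (ws , refl , unique , apexes)
    with any? (λ w → ¬? (hits? es a w) ×-dec ¬? (hits? es w b)) ws
  ... | yes survivor =
    let w , w∈ , aw-kept , wb-kept = find survivor
        aw , bw = All.lookup apexes w∈
    in w , (aw , aw-kept) , (sym H bw , wb-kept)
  ... | no none = ⊥-elim (≤⇒≯ es≤ℓ (injective-missing⇒< f-injective (Any.index ab∈) f-misses))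
    where
    cut : ∀ i → Broken (lookup ws i)
    cut i = broken _ (All.lookup (¬Any⇒All¬ ws none) (∈-lookup i))

    apex : ∀ i → Adj H a (lookup ws i) × Adj H b (lookup ws i)
    apex i = All.lookup apexes (∈-lookup i)

    f : Fin (length ws) → Fin (length es)
    f i = let _ , _ , _ , e∈ , _ = cut i in Any.index e∈

    f-misses : ∀ i → f i ≢ Any.index ab∈
    f-misses i eq with cut i | eq
    ... | o , _ , e , e∈ , same | eq′ with index-injective e∈ ab∈ eq′
    ... | refl with SameEdge-endpoint same
    ...   | inj₁ w≡a = apex-≢ (inj₁ refl) (apex i) (≡-sym w≡a)
    ...   | inj₂ w≡b = apex-≢ (inj₂ refl) (apex i) (≡-sym w≡b)

    f-injective : Injective _≡_ _≡_ f
    f-injective {i} {j} eq with cut i | cut j | eq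
    ... | _ , o₁∈ab , _ , e∈ , same₁ | _ , o₂∈ab , _ , e′∈ , same₂ | eq′ with index-injective e∈ e′∈ eq′
    ... | refl = lookup-injective unique
                   (SameEdge-far-end (apex-≢ o₁∈ab (apex j)) (apex-≢ o₂∈ab (apex i)) same₁ same₂)

proposition1 : ∀ {n} (G : Graph n) (s ℓ : ℕ) → 1 ≤ s → 1 ≤ ℓ
    → (S : VSet n) (G' : Graph n)
    → SpanningSubgraphOfInduced G S G'
    → (∀ u v → Adj G' u v → InAtLeastTriangles G' ℓ u v)
    → DiamLE G' S s
    → (es : List (Edge n)) → length es ≡ ℓ → DistinctEdgesOf G' es
    → DiamLE (removeEdges G' es) S (s + ℓ) × DiamLE (removeEdges G' es) S (2 * s)
proposition1 G s ℓ _ _ S G' _ triangles diam es refl (es⊆G' , _) = plus-ℓ , doubled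
  where
  bypasses : All (CommonNeighbour (removeEdges G' es)) es
  bypasses = All.tabulate λ {e} e∈ →
    triangle-survives {H = G'} es e∈ ≤-refl (triangles (proj₁ e) (proj₂ e) (All.lookup es⊆G' e∈))

  plus-ℓ : DiamLE (removeEdges G' es) S (s + length es)
  plus-ℓ u v su sv =
    DistLE-weaken (≤-reflexive (+-comm (length es) s)) (DistLE-removeEdges es bypasses (diam u v su sv))

  doubled : DiamLE (removeEdges G' es) S (2 * s)
  doubled u v su sv =
    DistLE-weaken (≤-reflexive (*-comm s 2)) (DistLE-stretch (DistLE-bypass bypasses) (diam u v su sv))
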